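{- Let $G$ be a bipartite graph of order $n$ with at least one edge, let $m\ge 3$, and let $H$ be the graph obtained from $G$ by attaching a complete graph $K_m$ on an edge of $G$ (i.e., $K_m$ shares exactly that edge with $G$). Then $sn(H)\le sn(G,m)+m-3$.
   Context: All graphs are finite, simple, undirected and connected. Let $G=(V,E)$ be a graph with chromatic number $\chi(G)$, let $k\ge\chi(G)$ and $S\subseteq V$. A proper $k$-coloring $C_0$ of the induced subgraph $G[S]$ is extendable if it extends to a proper $k$-coloring of $G$, and is a $k$-Sudoku coloring if it extends to exactly one proper $k$-coloring of $G$. The $k$-Sudoku number $sn(G,k)$ is the smallest $|S|$ such that $G[S]$ admits a $k$-Sudoku coloring, and the Sudoku number is $sn(G)=sn(G,\chi(G))$. -}

module Defs where

open import Data.Nat using (ℕ; zero; suc; _+_; _∸_; _≤_)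
open import Data.Fin using (Fin; splitAt)
open import Data.Fin.Subset using (Subset; _∈_; ∣_∣)
open import Data.Sum using (_⊎_; inj₁; inj₂)
open import Data.Product using (_×_; Σ; ∃; ∃-syntax)
open import Relation.Nullary using (¬_)
open import Relation.Binary.PropositionalEquality using (_≡_; _≢_)

Graph : ℕ → Set₁
Graph n = Fin n → Fin n → Set

IsSimple : ∀ {n} → Graph n → Set
IsSimple {n} G = (∀ u v → G u v → G v u) × (∀ v → ¬ G v v)

data Reach {n} (G : Graph n) : Fin n → Fin n → Set where
  here : ∀ {v} → Reach G v v
  step : ∀ {u v w} → G u v → Reach G v w → Reach G u w

Connected : ∀ {n} → Graph n → Set
Connected {n} G = ∀ u v → Reach G u v

Proper : ∀ {n} → Graph n → (k : ℕ) → (Fin n → Fin k) → Set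
Proper {n} G k c = ∀ u v → G u v → c u ≢ c v

Colorable : ∀ {n} → Graph n → ℕ → Set
Colorable {n} G k = ∃[ c ] Proper G k c

Bipartite : ∀ {n} → Graph n → Set
Bipartite G = Colorable G 2

IsChromaticNumber : ∀ {n} → Graph n → ℕ → Set
IsChromaticNumber G χ = Colorable G χ × (∀ k → Colorable G k → χ ≤ k)

-- A coloring c₀ of G[S] is represented by a total map whose values
-- outside S are irrelevant.
ProperOn : ∀ {n} → Graph n → (k : ℕ) → Subset n → (Fin n → Fin k) → Set
ProperOn {n} G k S c₀ = ∀ u v → u ∈ S → v ∈ S → G u v → c₀ u ≢ c₀ v

Extends : ∀ {n} → Graph n → (k : ℕ) → Subset n → (Fin n → Fin k) → (Fin n → Fin k) → Set
Extends {n} G k S c₀ c = Proper G k c × (∀ v → v ∈ S → c v ≡ c₀ v)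

IsSudokuColoring : ∀ {n} → Graph n → (k : ℕ) → Subset n → (Fin n → Fin k) → Set
IsSudokuColoring {n} G k S c₀ =
  ProperOn G k S c₀ ×
  (∃[ c ] Extends G k S c₀ c) ×
  (∀ c c′ → Extends G k S c₀ c → Extends G k S c₀ c′ → ∀ v → c v ≡ c′ v)

HasSudokuOfSize : ∀ {n} → Graph n → ℕ → ℕ → Set
HasSudokuOfSize {n} G k s =
  Σ (Subset n) λ S → Σ (Fin n → Fin k) λ c₀ → (∣ S ∣ ≡ s) × IsSudokuColoring G k S c₀

IsSudokuNumber : ∀ {n} → Graph n → ℕ → ℕ → Set
IsSudokuNumber G k s = HasSudokuOfSize G k s × (∀ t → HasSudokuOfSize G k t → s ≤ t)

IsSudokuNumber₀ : ∀ {n} → Graph n → ℕ → Set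
IsSudokuNumber₀ G s = ∃[ χ ] (IsChromaticNumber G χ × IsSudokuNumber G χ s)

-- Attach K_m on the edge {a,b} of G: add m-2 new vertices (indices n, n+1, ...),
-- pairwise adjacent and each adjacent to a and b.
attachClique : ∀ {n} → Graph n → (m : ℕ) → Fin n → Fin n → Graph (n + (m ∸ 2))
attachClique {n} G m a b x y with splitAt n x | splitAt n y
... | inj₁ u | inj₁ v = G u v
... | inj₁ u | inj₂ _ = (u ≡ a) ⊎ (u ≡ b)
... | inj₂ _ | inj₁ v = (v ≡ a) ⊎ (v ≡ b)
... | inj₂ i | inj₂ j = i ≢ j

{-# OPTIONS --safe #-}
module Submission where

-- Let c be the unique extension of a Sudoku coloring c₀ of G[S]. Since c(a) ≠ c(b), the
-- m − 2 new vertices of H can be colored bijectively by the remaining m − 2 colors; precolor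
-- all of them but one. In any extension d of this precoloring, d restricted to G extends c₀,
-- so equals c; the last new vertex then sees c(a), c(b) and m − 3 further colors, leaving one
-- choice. H contains K_m and is m-colorable, so χ(H) = m, and the precolored set has
-- |S| + m − 3 vertices.

open import Defs
open import Data.Nat using (ℕ; zero; suc; _+_; _∸_; _≤_; s≤s; z≤n)
open import Data.Nat.Properties using (≤-antisym)
open import Data.Fin using (Fin; zero; suc; splitAt; _↑ˡ_; _↑ʳ_; punchIn; punchOut; _≟_)
open import Data.Fin.Properties
  using (splitAt-↑ˡ; splitAt-↑ʳ; splitAt⁻¹-↑ˡ; splitAt⁻¹-↑ʳ; punchIn-punchOut; punchInᵢ≢i; punchIn-injective; injective⇒≤)
open import Data.Fin.Subset using (Subset; inside; outside; ⊤; _∈_; ∣_∣)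
open import Data.Fin.Subset.Properties using (∣⊤∣≡n; ∈⊤)
open import Data.Vec using ([]; _∷_; _++_; here; there)
open import Data.Sum using (_⊎_; inj₁; inj₂; [_,_]′)
open import Data.Product using (∃-syntax; _,_; proj₁; proj₂)
open import Function using (id; _∘_; Injective; _⇔_; mk⇔; Equivalence)
open import Relation.Nullary using (yes; no; contradiction)
open import Relation.Binary.PropositionalEquality

open Equivalence using (to; from)

∣p++q∣≡∣p∣+∣q∣ : ∀ {k l} (p : Subset k) (q : Subset l) → ∣ p ++ q ∣ ≡ ∣ p ∣ + ∣ q ∣
∣p++q∣≡∣p∣+∣q∣ []            q = refl
∣p++q∣≡∣p∣+∣q∣ (outside ∷ p) q = ∣p++q∣≡∣p∣+∣q∣ p q
∣p++q∣≡∣p∣+∣q∣ (inside ∷ p)  q = cong suc (∣p++q∣≡∣p∣+∣q∣ p q)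

∈-++⁺ˡ : ∀ {k l} {p : Subset k} (q : Subset l) {x} → x ∈ p → x ↑ˡ l ∈ p ++ q
∈-++⁺ˡ q here      = here
∈-++⁺ˡ q (there x∈p) = there (∈-++⁺ˡ q x∈p)

∈-++⁺ʳ : ∀ {k l} (p : Subset k) {q : Subset l} {x} → x ∈ q → k ↑ʳ x ∈ p ++ q
∈-++⁺ʳ []      x∈q = x∈q
∈-++⁺ʳ (_ ∷ p) x∈q = there (∈-++⁺ʳ p x∈q)

module _ {j} {x y : Fin (suc (suc j))} (x≢y : x ≢ y) where

  punchIn₂ : Fin j → Fin (suc (suc j))
  punchIn₂ i = punchIn x (punchIn (punchOut x≢y) i)

  punchIn₂≢x : ∀ i → punchIn₂ i ≢ x
  punchIn₂≢x i = punchInᵢ≢i x _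

  punchIn₂≢y : ∀ i → punchIn₂ i ≢ y
  punchIn₂≢y i eq = punchInᵢ≢i (punchOut x≢y) i
    (punchIn-injective x _ _ (trans eq (sym (punchIn-punchOut x≢y))))

  punchIn₂-injective : Injective _≡_ _≡_ punchIn₂
  punchIn₂-injective eq = punchIn-injective _ _ _ (punchIn-injective x _ _ eq)

  punchIn₂-onto : ∀ {z} → z ≢ x → z ≢ y → ∃[ i ] punchIn₂ i ≡ z
  punchIn₂-onto {z} z≢x z≢y = punchOut y′≢z′ , (begin
      punchIn x (punchIn y′ (punchOut y′≢z′)) ≡⟨ cong (punchIn x) (punchIn-punchOut y′≢z′) ⟩
      punchIn x z′                            ≡⟨ punchIn-punchOut x≢z ⟩
      z                                       ∎)
    where
    open ≡-Reasoning
    x≢z : x ≢ z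
    x≢z = z≢x ∘ sym
    y′ z′ : Fin (suc j)
    y′ = punchOut x≢y
    z′ = punchOut x≢z
    y′≢z′ : y′ ≢ z′
    y′≢z′ eq = z≢y (begin
      z            ≡⟨ punchIn-punchOut x≢z ⟨
      punchIn x z′ ≡⟨ cong (punchIn x) eq ⟨
      punchIn x y′ ≡⟨ punchIn-punchOut x≢y ⟩
      y            ∎)

IsClique : ∀ {n m} → Graph n → (Fin m → Fin n) → Set
IsClique G K = ∀ p q → p ≢ q → G (K p) (K q)

clique-size≤colors : ∀ {n m k} {G : Graph n} {K : Fin m → Fin n} →
                     IsClique G K → Colorable G k → m ≤ k
clique-size≤colors {K = K} clique (c , c-proper) = injective⇒≤ c∘K-injective
  where
  c∘K-injective : Injective _≡_ _≡_ (c ∘ K)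
  c∘K-injective {p} {q} eq with p ≟ q
  ... | yes p≡q = p≡q
  ... | no  p≢q = contradiction eq (c-proper (K p) (K q) (clique p q p≢q))

module AttachClique {n j : ℕ} (G : Graph n) (a b : Fin n) where

  H : Graph (n + j)
  H = attachClique G (suc (suc j)) a b

  data Vertex : Fin (n + j) → Set where
    old : ∀ u → Vertex (u ↑ˡ j)
    new : ∀ i → Vertex (n ↑ʳ i)

  vertex : ∀ x → Vertex x
  vertex x with splitAt n x in eq
  ... | inj₁ u = subst Vertex (splitAt⁻¹-↑ˡ eq) (old u)
  ... | inj₂ i = subst Vertex (splitAt⁻¹-↑ʳ eq) (new i)

  H-old-old : ∀ u v → H (u ↑ˡ j) (v ↑ˡ j) ⇔ G u v
  H-old-old u v rewrite splitAt-↑ˡ n u j | splitAt-↑ˡ n v j = mk⇔ id id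

  H-old-new : ∀ u i → H (u ↑ˡ j) (n ↑ʳ i) ⇔ (u ≡ a ⊎ u ≡ b)
  H-old-new u i rewrite splitAt-↑ˡ n u j | splitAt-↑ʳ n j i = mk⇔ id id

  H-new-old : ∀ i v → H (n ↑ʳ i) (v ↑ˡ j) ⇔ (v ≡ a ⊎ v ≡ b)
  H-new-old i v rewrite splitAt-↑ʳ n j i | splitAt-↑ˡ n v j = mk⇔ id id

  H-new-new : ∀ i i′ → H (n ↑ʳ i) (n ↑ʳ i′) ⇔ (i ≢ i′)
  H-new-new i i′ rewrite splitAt-↑ʳ n j i | splitAt-↑ʳ n j i′ = mk⇔ id id

  clique : Fin (suc (suc j)) → Fin (n + j)
  clique zero          = a ↑ˡ j
  clique (suc zero)    = b ↑ˡ j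
  clique (suc (suc i)) = n ↑ʳ i

  clique-isClique : G a b → G b a → IsClique H clique
  clique-isClique ab ba zero          zero          0≢0 = contradiction refl 0≢0
  clique-isClique ab ba zero          (suc zero)    _   = from (H-old-old a b) ab
  clique-isClique ab ba zero          (suc (suc i)) _   = from (H-old-new a i) (inj₁ refl)
  clique-isClique ab ba (suc zero)    zero          _   = from (H-old-old b a) ba
  clique-isClique ab ba (suc zero)    (suc zero)    1≢1 = contradiction refl 1≢1
  clique-isClique ab ba (suc zero)    (suc (suc i)) _   = from (H-old-new b i) (inj₂ refl)
  clique-isClique ab ba (suc (suc i)) zero          _   = from (H-new-old i a) (inj₁ refl)
  clique-isClique ab ba (suc (suc i)) (suc zero)    _   = from (H-new-old i b) (inj₂ refl)
  clique-isClique ab ba (suc (suc i)) (suc (suc i′)) p≢q =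
    from (H-new-new i i′) λ { refl → p≢q refl }

  module _ {c : Fin n → Fin (suc (suc j))} (c-proper : Proper G _ c) (ab : G a b) where

    ca≢cb : c a ≢ c b
    ca≢cb = c-proper a b ab

    extend : Fin (n + j) → Fin (suc (suc j))
    extend x = [ c , punchIn₂ ca≢cb ]′ (splitAt n x)

    extend-old : ∀ u → extend (u ↑ˡ j) ≡ c u
    extend-old u = cong [ c , punchIn₂ ca≢cb ]′ (splitAt-↑ˡ n u j)

    extend-new : ∀ i → extend (n ↑ʳ i) ≡ punchIn₂ ca≢cb i
    extend-new i = cong [ c , punchIn₂ ca≢cb ]′ (splitAt-↑ʳ n j i)

    endpoint≢new : ∀ u i → u ≡ a ⊎ u ≡ b → c u ≢ punchIn₂ ca≢cb i
    endpoint≢new .a i (inj₁ refl) = punchIn₂≢x ca≢cb i ∘ sym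
    endpoint≢new .b i (inj₂ refl) = punchIn₂≢y ca≢cb i ∘ sym

    extend-proper : Proper H _ extend
    extend-proper x y xy with vertex x | vertex y
    ... | old u | old v rewrite extend-old u | extend-old v =
      c-proper u v (to (H-old-old u v) xy)
    ... | old u | new i rewrite extend-old u | extend-new i =
      endpoint≢new u i (to (H-old-new u i) xy)
    ... | new i | old v rewrite extend-new i | extend-old v =
      endpoint≢new v i (to (H-new-old i v) xy) ∘ sym
    ... | new i | new i′ rewrite extend-new i | extend-new i′ =
      to (H-new-new i i′) xy ∘ punchIn₂-injective ca≢cb

  attachClique-χ : ∀ {χ} → G a b → G b a → Colorable G (suc (suc j)) →
                   IsChromaticNumber H χ → χ ≡ suc (suc j)
  attachClique-χ ab ba (c , c-proper) (H-colorable , minimal) = ≤-antisym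
    (minimal _ (extend c-proper ab , extend-proper c-proper ab))
    (clique-size≤colors (clique-isClique ab ba) H-colorable)

module _ {n k : ℕ} (G : Graph n) (a b : Fin n) where
  open AttachClique {j = suc k} G a b

  module _ {S : Subset n} {c₀ c : Fin n → Fin (suc (suc (suc k)))}
           (c-extends : Extends G _ S c₀ c)
           (unique : ∀ d d′ → Extends G _ S c₀ d → Extends G _ S c₀ d′ → ∀ v → d v ≡ d′ v)
           (ab : G a b) where

    private
      c-proper : Proper G _ c
      c-proper = proj₁ c-extends

    c′ : Fin (n + suc k) → Fin (suc (suc (suc k)))
    c′ = extend c-proper ab

    S′ : Subset (n + suc k)
    S′ = S ++ (outside ∷ ⊤)

    new-suc∈S′ : ∀ i → n ↑ʳ suc i ∈ S′
    new-suc∈S′ i = ∈-++⁺ʳ S (there ∈⊤)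

    restriction-extends : ∀ {d} → Extends H _ S′ c′ d → Extends G _ S c₀ (d ∘ (_↑ˡ suc k))
    restriction-extends (d-proper , d≡c′) =
      (λ u v uv → d-proper _ _ (from (H-old-old u v) uv)) ,
      λ v v∈S → trans (d≡c′ _ (∈-++⁺ˡ _ v∈S)) (trans (extend-old c-proper ab v) (proj₂ c-extends v v∈S))

    forced-old : ∀ {d} → Extends H _ S′ c′ d → ∀ u → d (u ↑ˡ suc k) ≡ c u
    forced-old d-extends = unique _ _ (restriction-extends d-extends) c-extends

    new₀≢endpoint : ∀ {d} → Extends H _ S′ c′ d → ∀ u → u ≡ a ⊎ u ≡ b → d (n ↑ʳ zero) ≢ c u
    new₀≢endpoint d-extends@(d-proper , _) u adj eq =
      d-proper _ _ (from (H-new-old zero u) adj) (trans eq (sym (forced-old d-extends u)))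

    forced-new₀ : ∀ {d} → Extends H _ S′ c′ d → d (n ↑ʳ zero) ≡ c′ (n ↑ʳ zero)
    forced-new₀ d-extends@(d-proper , d≡c′)
      with punchIn₂-onto (ca≢cb c-proper ab) (new₀≢endpoint d-extends a (inj₁ refl))
                                             (new₀≢endpoint d-extends b (inj₂ refl))
    ... | zero  , eq = trans (sym eq) (sym (extend-new c-proper ab zero))
    ... | suc i , eq = contradiction
      (trans (sym eq) (trans (sym (extend-new c-proper ab (suc i))) (sym (d≡c′ _ (new-suc∈S′ i)))))
      (d-proper _ _ (from (H-new-new zero (suc i)) λ ()))

    forced : ∀ {d} → Extends H _ S′ c′ d → ∀ x → d x ≡ c′ x
    forced d-extends@(_ , d≡c′) x with vertex x
    ... | old u       = trans (forced-old d-extends u) (sym (extend-old c-proper ab u))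
    ... | new zero    = forced-new₀ d-extends
    ... | new (suc i) = d≡c′ _ (new-suc∈S′ i)

    extend-sudoku : IsSudokuColoring H _ S′ c′
    extend-sudoku =
      (λ u v _ _ → extend-proper c-proper ab u v) ,
      (c′ , extend-proper c-proper ab , λ _ _ → refl) ,
      λ d d′ d-extends d′-extends x → trans (forced d-extends x) (sym (forced d′-extends x))

    ∣S′∣≡∣S∣+k : ∣ S′ ∣ ≡ ∣ S ∣ + k
    ∣S′∣≡∣S∣+k = trans (∣p++q∣≡∣p∣+∣q∣ S _) (cong (∣ S ∣ +_) (∣⊤∣≡n k))

  attachClique-sudoku : ∀ {s} → G a b → HasSudokuOfSize G (suc (suc (suc k))) s →
                        HasSudokuOfSize H (suc (suc (suc k))) (s + k)
  attachClique-sudoku ab (S , c₀ , ∣S∣≡s , _ , (c , c-extends) , unique) =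
    S′ c-extends unique ab , c′ c-extends unique ab ,
    trans (∣S′∣≡∣S∣+k c-extends unique ab) (cong (_+ k) ∣S∣≡s) ,
    extend-sudoku c-extends unique ab

sudoku⇒colorable : ∀ {n} {G : Graph n} {k s} → HasSudokuOfSize G k s → Colorable G k
sudoku⇒colorable (_ , _ , _ , _ , (c , c-proper , _) , _) = c , c-proper

mainTheorem7 : ∀ {n} (G : Graph n) (m : ℕ) (a b : Fin n) →
    IsSimple G → Connected G → Bipartite G → G a b → 3 ≤ m →
    ∀ s t → IsSudokuNumber G m s → IsSudokuNumber₀ (attachClique G m a b) t →
    t ≤ s + (m ∸ 3)
mainTheorem7 G (suc (suc (suc k))) a b (symmetric , _) _ _ ab (s≤s (s≤s (s≤s z≤n)))
             s t (G-sudoku , _) (χ , H-χ , _ , minimal)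
  with AttachClique.attachClique-χ G a b ab (symmetric a b ab) (sudoku⇒colorable G-sudoku) H-χ
... | refl = minimal (s + k) (attachClique-sudoku G a b ab G-sudoku)
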